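{- Let $T=(V,E)$ be a tree rooted at a vertex $r$ (denote the rooted tree $T_r$), let $k\ge1$ be an integer and let $B\subseteq V$. If $T_r$ has a leaf $v$ with $v\notin B$, then $\Gamma_V(B)=\Gamma_{V\setminus\{v\}}(B)$.
   Context: All distances $d_{T_r}(u,w)$ are hop-distances in the tree $T$. A leaf of $T_r$ is a vertex with no children in $T_r$. For $W\subseteq V$ and $B\subseteq V$, a partial $k$-hop dominating set of $B$ from $W$ is a set $D\subseteq W$ such that for every $b\in B$ there is $u\in D$ with $d_{T_r}(u,b)\le k$; $\Gamma_W(B)$ denotes the minimum cardinality of such a set $D$. -}

module Defs where

open import Data.Nat using (ℕ; zero; suc; _≤_)
open import Data.Fin using (Fin)
open import Data.Fin.Subset using (Subset; _∈_; _⊆_; ∣_∣)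
open import Data.Product using (Σ; ∃; _×_)
open import Data.Sum using (_⊎_)
open import Function using (_∘_)
open import Relation.Binary.PropositionalEquality using (_≡_; _≢_)

iter : {A : Set} → (A → A) → ℕ → A → A
iter f zero    x = x
iter f (suc j) x = f (iter f j x)

-- The root r is its own "parent" (a convention); every other vertex u
-- is joined by an edge to parent u.  Every vertex reaches the root by
-- following parents, so the underlying graph is a tree rooted at r.
record RootedTree (n : ℕ) : Set where
  field
    root       : Fin n
    parent     : Fin n → Fin n
    parent-root : parent root ≡ root
    reaches    : ∀ v → ∃ λ j → iter parent j v ≡ root

module _ {n : ℕ} (T : RootedTree n) where
  open RootedTree T

  Adj : Fin n → Fin n → Set
  Adj u w = (u ≢ root × parent u ≡ w) ⊎ (w ≢ root × parent w ≡ u)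

  data Walk : Fin n → Fin n → ℕ → Set where
    here : ∀ {u} → Walk u u zero
    step : ∀ {u w x ℓ} → Adj u w → Walk w x ℓ → Walk u x (suc ℓ)

  DistLe : Fin n → Fin n → ℕ → Set
  DistLe u w k = ∃ λ ℓ → Walk u w ℓ × ℓ ≤ k

  IsLeaf : Fin n → Set
  IsLeaf v = ∀ u → u ≢ root → parent u ≢ v

  IsPartialDom : ℕ → Subset n → Subset n → Subset n → Set
  IsPartialDom k W B D =
    D ⊆ W × (∀ {b} → b ∈ B → ∃ λ u → u ∈ D × DistLe u b k)

  IsΓ : ℕ → Subset n → Subset n → ℕ → Set
  IsΓ k W B m =
    (∃ λ D → IsPartialDom k W B D × ∣ D ∣ ≡ m)
    × (∀ D → IsPartialDom k W B D → m ≤ ∣ D ∣)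

-- A dominating set that uses the leaf v can trade v for its parent: a walk of
-- length ≤ k from v to a vertex b ≠ v must first step to the parent, so the
-- parent reaches b within k hops.  The trade does not increase the size, so the
-- minimum over V is attained by a set avoiding v and the two minima agree.
-- Minima exist because domination is decidable on the finite vertex set.
module Submission where

open import Defs
open import Data.Nat using (ℕ; zero; suc; _+_; _≤_; _<_; z≤n; s≤s)
open import Data.Nat.Properties
  using (≤-refl; ≤-trans; ≤-reflexive; +-suc; +-comm; +-monoʳ-≤; ≮⇒≥; m≤n⇒m≤1+n;
         m<1+n⇒m≤n; anyUpTo?; module ≤-Reasoning)
  renaming (_≟_ to _≟ℕ_)
open import Data.Nat.Induction using (<-wellFounded)
open import Data.Fin using (Fin; zero; suc; _≟_)
open import Data.Fin.Properties using (any?; all?)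
open import Data.Fin.Subset using (Subset; inside; outside; _∈_; _∉_; _⊆_; ∣_∣; ⊤; _-_; _∪_; ⁅_⁆)
open import Data.Fin.Subset.Properties
  using (_∈?_; _⊆?_; anySubset?; ∈⊤; x∈⁅x⁆; x∈p∪q⁺; x∈p∧x≢y⇒x∈p-y; x∈p⇒∣p-x∣<∣p∣; ∣⁅x⁆∣≡1)
open import Data.Vec using ([]; _∷_; there)
open import Data.Product using (∃; _×_; _,_)
open import Data.Sum using (inj₁; inj₂)
open import Data.Empty using (⊥-elim)
open import Induction.WellFounded using (Acc; acc)
open import Relation.Nullary using (Dec; yes; no; ¬?)
open import Relation.Nullary.Decidable using (_×-dec_; _⊎-dec_; _→-dec_; map′)
open import Relation.Unary using (Pred; Decidable)
open import Relation.Binary.PropositionalEquality using (_≡_; _≢_; refl; sym; trans; cong)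

∣p∪q∣≤∣p∣+∣q∣ : ∀ {n} (p q : Subset n) → ∣ p ∪ q ∣ ≤ ∣ p ∣ + ∣ q ∣
∣p∪q∣≤∣p∣+∣q∣ []            []            = z≤n
∣p∪q∣≤∣p∣+∣q∣ (outside ∷ p) (outside ∷ q) = ∣p∪q∣≤∣p∣+∣q∣ p q
∣p∪q∣≤∣p∣+∣q∣ (outside ∷ p) (inside  ∷ q) =
  ≤-trans (s≤s (∣p∪q∣≤∣p∣+∣q∣ p q)) (≤-reflexive (sym (+-suc ∣ p ∣ ∣ q ∣)))
∣p∪q∣≤∣p∣+∣q∣ (inside  ∷ p) (outside ∷ q) = s≤s (∣p∪q∣≤∣p∣+∣q∣ p q)
∣p∪q∣≤∣p∣+∣q∣ (inside  ∷ p) (inside  ∷ q) =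
  s≤s (≤-trans (∣p∪q∣≤∣p∣+∣q∣ p q) (+-monoʳ-≤ ∣ p ∣ (m≤n⇒m≤1+n ≤-refl)))

x∉p-x : ∀ {n} (x : Fin n) (p : Subset n) → x ∉ p - x
x∉p-x zero    (_ ∷ p) ()
x∉p-x (suc x) (_ ∷ p) (there x∈p-x) = x∉p-x x p x∈p-x

x∈p-y⇒x≢y : ∀ {n} {x y : Fin n} {p : Subset n} → x ∈ p - y → x ≢ y
x∈p-y⇒x≢y {x = x} {p = p} x∈p-x refl = x∉p-x x p x∈p-x

p-x⊆⊤-x : ∀ {n} (p : Subset n) (x : Fin n) → p - x ⊆ ⊤ - x
p-x⊆⊤-x p x y∈p-x = x∈p∧x≢y⇒x∈p-y ∈⊤ (x∈p-y⇒x≢y y∈p-x)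

x∉p⇒p⊆⊤-x : ∀ {n} {x : Fin n} {p : Subset n} → x ∉ p → p ⊆ ⊤ - x
x∉p⇒p⊆⊤-x x∉p y∈p = x∈p∧x≢y⇒x∈p-y ∈⊤ λ { refl → x∉p y∈p }

module _ {ℓ} {P : Pred ℕ ℓ} (P? : Decidable P) where

  least-witness : ∀ {N} → P N → ∃ λ m → P m × (∀ j → P j → m ≤ j)
  least-witness {N} = go (<-wellFounded N)
    where
    go : ∀ {N} → Acc _<_ N → P N → ∃ λ m → P m × (∀ j → P j → m ≤ j)
    go {N} (acc rs) pN with anyUpTo? P? N
    ... | yes (j , j<N , pj) = go (rs j<N) pj
    ... | no none            = N , pN , λ j pj → ≮⇒≥ λ j<N → none (j , j<N , pj)

module _ {n : ℕ} (T : RootedTree n) where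
  open RootedTree T

  iter-fixed : ∀ {v} j → parent v ≡ v → iter parent j v ≡ v
  iter-fixed zero    _ = refl
  iter-fixed (suc j) e = trans (cong parent (iter-fixed j e)) e

  parent-fixed⇒root : ∀ {v} → parent v ≡ v → v ≡ root
  parent-fixed⇒root {v} e with reaches v
  ... | j , iter≡root = trans (sym (iter-fixed j e)) iter≡root

  Adj? : ∀ u w → Dec (Adj T u w)
  Adj? u w = (¬? (u ≟ root) ×-dec (parent u ≟ w)) ⊎-dec (¬? (w ≟ root) ×-dec (parent w ≟ u))

  Walk? : ∀ ℓ u w → Dec (Walk T u w ℓ)
  Walk? zero    u w = map′ (λ { refl → here }) (λ { here → refl }) (u ≟ w)
  Walk? (suc ℓ) u w = map′ (λ { (_ , a , wk) → step a wk }) (λ { (step a wk) → _ , a , wk })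
                        (any? λ x → Adj? u x ×-dec Walk? ℓ x w)

  DistLe? : ∀ k u w → Dec (DistLe T u w k)
  DistLe? k u w = map′ (λ { (ℓ , ℓ<1+k , wk) → ℓ , wk , m<1+n⇒m≤n ℓ<1+k })
                       (λ { (ℓ , wk , ℓ≤k) → ℓ , s≤s ℓ≤k , wk })
                       (anyUpTo? (λ ℓ → Walk? ℓ u w) (suc k))

  IsPartialDom? : ∀ k W B D → Dec (IsPartialDom T k W B D)
  IsPartialDom? k W B D = (D ⊆? W) ×-dec
    map′ (λ dom {b} → dom b) (λ dom b → dom)
      (all? λ b → (b ∈? B) →-dec any? λ u → (u ∈? D) ×-dec DistLe? k u b)

  self-dominating : ∀ {k W B} → B ⊆ W → IsPartialDom T k W B B
  self-dominating B⊆W = B⊆W , λ {b} b∈B → b , b∈B , zero , here , z≤n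

  HasPartialDomOfSize : ℕ → Subset n → Subset n → ℕ → Set
  HasPartialDomOfSize k W B m = ∃ λ D → IsPartialDom T k W B D × ∣ D ∣ ≡ m

  HasPartialDomOfSize? : ∀ k W B → Decidable (HasPartialDomOfSize k W B)
  HasPartialDomOfSize? k W B m = anySubset? λ D → IsPartialDom? k W B D ×-dec (∣ D ∣ ≟ℕ m)

  IsΓ-exists : ∀ {k W B} D → IsPartialDom T k W B D → ∃ (IsΓ T k W B)
  IsΓ-exists {k} {W} {B} D dom with least-witness (HasPartialDomOfSize? k W B) (D , dom , refl)
  ... | m , witness , minimal = m , witness , λ D′ dom′ → minimal ∣ D′ ∣ (D′ , dom′ , refl)

  IsΓ-transfer : ∀ {k W W′ B m} → W′ ⊆ W →
    (∀ D → IsPartialDom T k W B D → ∃ λ D′ → IsPartialDom T k W′ B D′ × ∣ D′ ∣ ≤ ∣ D ∣) →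
    IsΓ T k W′ B m → IsΓ T k W B m
  IsΓ-transfer {k} {W} {_} {B} {m} W′⊆W trade ((D , (D⊆W′ , dom) , ∣D∣≡m) , minimal) =
    (D , ((λ x∈D → W′⊆W (D⊆W′ x∈D)) , dom) , ∣D∣≡m) , bound
    where
    bound : ∀ E → IsPartialDom T k W B E → m ≤ ∣ E ∣
    bound E domE with trade E domE
    ... | E′ , domE′ , ∣E′∣≤∣E∣ = ≤-trans (minimal E′ domE′) ∣E′∣≤∣E∣

  DistLe-from-leaf : ∀ {v b k} → IsLeaf T v → b ≢ v → DistLe T v b k →
    v ≢ root × DistLe T (parent v) b k
  DistLe-from-leaf leaf b≢v (_ , here , _) = ⊥-elim (b≢v refl)
  DistLe-from-leaf leaf b≢v (suc ℓ , step (inj₁ (v≢root , refl)) wk , 1+ℓ≤k) =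
    v≢root , ℓ , wk , ≤-trans (m≤n⇒m≤1+n ≤-refl) 1+ℓ≤k
  DistLe-from-leaf leaf b≢v (_ , step (inj₂ (w≢root , parent-w≡v)) _ , _) =
    ⊥-elim (leaf _ w≢root parent-w≡v)

  avoid-leaf : ∀ {k B v} → IsLeaf T v → v ∉ B →
    ∀ D → IsPartialDom T k ⊤ B D → ∃ λ D′ → IsPartialDom T k (⊤ - v) B D′ × ∣ D′ ∣ ≤ ∣ D ∣
  avoid-leaf {k} {B} {v} leaf v∉B D (_ , dom) with v ∈? D
  ... | no v∉D  = D , (x∉p⇒p⊆⊤-x v∉D , dom) , ≤-refl
  ... | yes v∈D = (D ∪ ⁅ parent v ⁆) - v , (p-x⊆⊤-x _ v , dom′) , size
    where
    dom′ : ∀ {b} → b ∈ B → ∃ λ u → u ∈ (D ∪ ⁅ parent v ⁆) - v × DistLe T u b k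
    dom′ b∈B with dom b∈B
    ... | u , u∈D , u↝b with u ≟ v
    ...   | no u≢v  = u , x∈p∧x≢y⇒x∈p-y (x∈p∪q⁺ (inj₁ u∈D)) u≢v , u↝b
    ...   | yes refl with DistLe-from-leaf leaf (λ { refl → v∉B b∈B }) u↝b
    ...     | v≢root , parent↝b =
      parent v , x∈p∧x≢y⇒x∈p-y (x∈p∪q⁺ (inj₂ (x∈⁅x⁆ _))) (λ e → v≢root (parent-fixed⇒root e)) ,
      parent↝b
    size : ∣ (D ∪ ⁅ parent v ⁆) - v ∣ ≤ ∣ D ∣
    size = m<1+n⇒m≤n (begin-strict
      ∣ (D ∪ ⁅ parent v ⁆) - v ∣  <⟨ x∈p⇒∣p-x∣<∣p∣ (x∈p∪q⁺ (inj₁ v∈D)) ⟩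
      ∣ D ∪ ⁅ parent v ⁆ ∣        ≤⟨ ∣p∪q∣≤∣p∣+∣q∣ D ⁅ parent v ⁆ ⟩
      ∣ D ∣ + ∣ ⁅ parent v ⁆ ∣    ≡⟨ cong (∣ D ∣ +_) (∣⁅x⁆∣≡1 (parent v)) ⟩
      ∣ D ∣ + 1                   ≡⟨ +-comm ∣ D ∣ 1 ⟩
      suc ∣ D ∣                   ∎)
      where open ≤-Reasoning

mainTheorem5 : ∀ {n} (T : RootedTree n) (k : ℕ) → 1 ≤ k → (B : Subset n) (v : Fin n) →
    IsLeaf T v → v ∉ B →
    ∃ λ m → IsΓ T k ⊤ B m × IsΓ T k (⊤ - v) B m
mainTheorem5 T k _ B v leaf v∉B with IsΓ-exists T B (self-dominating T (x∉p⇒p⊆⊤-x v∉B))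
... | m , Γ-avoiding-v = m , IsΓ-transfer T (λ _ → ∈⊤) (avoid-leaf T leaf v∉B) Γ-avoiding-v , Γ-avoiding-v
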